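{- For $r\ge 1$ let $G_r=\mathbb{Z}_2^r$ be the elementary abelian $2$-group of rank $r$. Then $$\lim_{r\to\infty}\bigl(C_4(G_r)-Z_4(G_r)\bigr)=\infty.$$
   Context: For a finite abelian group $G$ (written additively), a subset $A\subseteq G$ and a positive integer $h$, $h\hat{\;}A$ is the set of all sums of $h$ pairwise distinct elements of $A$. Define $C_h(G)=\max\{|A| : A\subseteq G,\ h\hat{\;}A\neq G\}$ and $Z_h(G)=\max\{|A| : A\subseteq G,\ 0\notin h\hat{\;}A\}$. -}

module Defs where

open import Data.Nat using (ℕ; _≤_)
open import Data.Bool using (Bool; false; _xor_)
open import Data.Vec using (Vec; zipWith; replicate)
open import Data.List using (List; length; foldr)
open import Data.List.Relation.Unary.Unique.Propositional using (Unique)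
open import Data.List.Relation.Binary.Sublist.Propositional using (_⊆_)
open import Data.Product using (Σ; _×_; ∃)
open import Relation.Binary.PropositionalEquality using (_≡_)
open import Relation.Nullary using (¬_)

G : ℕ → Set
G r = Vec Bool r

_⊕_ : ∀ {r} → G r → G r → G r
_⊕_ = zipWith _xor_

𝟘 : ∀ {r} → G r
𝟘 = replicate _ false

sumG : ∀ {r} → List (G r) → G r
sumG = foldr _⊕_ 𝟘

-- A finite subset of G r is represented by a duplicate-free list (Unique);
-- its cardinality is the length of the list.
-- g ∈ h^A : g is the sum of h pairwise distinct elements of A, i.e. of a
-- sublist of A of length h (A is duplicate-free).
InRestrictedSumset : ∀ {r} → ℕ → List (G r) → G r → Set
InRestrictedSumset h A g = Σ (List _) λ S → S ⊆ A × length S ≡ h × sumG S ≡ g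

SumsetNotAll : ∀ {r} → ℕ → List (G r) → Set
SumsetNotAll h A = ∃ λ g → ¬ InRestrictedSumset h A g

ZeroFree : ∀ {r} → ℕ → List (G r) → Set
ZeroFree h A = ¬ InRestrictedSumset h A 𝟘

IsMaxSize : (r : ℕ) → (List (G r) → Set) → ℕ → Set
IsMaxSize r P n =
  (Σ (List (G r)) λ A → Unique A × P A × length A ≡ n) ×
  (∀ (A : List (G r)) → Unique A → P A → length A ≤ n)

IsC : ℕ → ℕ → ℕ → Set
IsC h r n = IsMaxSize r (SumsetNotAll h) n

IsZ : ℕ → ℕ → ℕ → Set
IsZ h r n = IsMaxSize r (ZeroFree h) n

{-# OPTIONS --safe #-}
-- The hyperplane {0} × G_{r-1} is closed under addition, so no sum of its
-- elements hits a vector with first coordinate 1: hence C_4(G_r) ≥ 2^(r-1). Conversely,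
-- let A = {a, b, c} ∪ L be 4-zero-free. In G_r we have u + v + x + y = 0 iff
-- x + y = u + v, so for distinct u, v ∈ {a, b, c} the sum u + v is not of the form x + y
-- with x, y ∈ L (for x = y it would force u = v). Hence the translates a + L, b + L,
-- c + L are pairwise disjoint, 3 (|A| - 3) ≤ 2^r and Z_4(G_r) ≤ (2^r + 9) / 3.
-- The difference of the two bounds is about 2^r / 6.
module Submission where

open import Data.Nat using (ℕ; _+_; _≤_)
open import Data.Product using (∃)
open import Defs

open import Data.Bool using (Bool; true; false; _xor_)
open import Data.Bool.Properties as Bool
  using (xor-assoc; xor-comm; xor-identityˡ; xor-identityʳ; xor-same)
open import Data.Empty using (⊥-elim)
open import Data.List using (List; []; _∷_; _++_; map; concatMap; length)
open import Data.List.Properties using (length-++; length-map; length-removeAt′)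
open import Data.List.Membership.Propositional using (_∈_; _─_)
open import Data.List.Membership.Propositional.Properties
  using (∈-map⁺; ∈-map⁻; ∈-++⁺ˡ; ∈-++⁺ʳ)
open import Data.List.Relation.Binary.Disjoint.Propositional using (Disjoint)
open import Data.List.Relation.Binary.Sublist.Propositional
  using (_⊆_; _∷_; _∷ʳ_; ⊆-refl; ⊆-trans; from∈)
open import Data.List.Relation.Binary.Sublist.Propositional.Properties using (All-resp-⊆)
open import Data.List.Relation.Unary.All as All using (All; []; _∷_)
import Data.List.Relation.Unary.All.Properties as All
open import Data.List.Relation.Unary.AllPairs as AllPairs using (AllPairs; []; _∷_)
import Data.List.Relation.Unary.AllPairs.Properties as AllPairs
open import Data.List.Relation.Unary.Any using (here; there; index)
open import Data.List.Relation.Unary.Unique.Propositional using (Unique)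
import Data.List.Relation.Unary.Unique.Propositional.Properties as Unique
open import Data.Nat using (zero; suc; _*_; _^_; _<_; z≤n; s≤s)
open import Data.Nat.Properties
open import Data.Product using (_,_)
open import Data.Sum using (_⊎_; inj₁; inj₂)
open import Data.Vec using ([]; _∷_; head; tail)
open import Data.Vec.Properties
  using (≡-dec; zipWith-assoc; zipWith-comm; zipWith-identityˡ; zipWith-identityʳ)
open import Function using (_∘_)
open import Relation.Nullary using (yes; no)
open import Relation.Binary.PropositionalEquality

private
  variable
    r : ℕ

⊕-assoc : ∀ (x y z : G r) → (x ⊕ y) ⊕ z ≡ x ⊕ (y ⊕ z)
⊕-assoc = zipWith-assoc xor-assoc

⊕-comm : ∀ (x y : G r) → x ⊕ y ≡ y ⊕ x
⊕-comm = zipWith-comm xor-comm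

⊕-identityˡ : ∀ (x : G r) → 𝟘 ⊕ x ≡ x
⊕-identityˡ = zipWith-identityˡ xor-identityˡ

⊕-identityʳ : ∀ (x : G r) → x ⊕ 𝟘 ≡ x
⊕-identityʳ = zipWith-identityʳ xor-identityʳ

⊕-self : ∀ (x : G r) → x ⊕ x ≡ 𝟘
⊕-self []       = refl
⊕-self (b ∷ x) = cong₂ _∷_ (xor-same b) (⊕-self x)

⊕-cancelˡ : ∀ (x y : G r) → x ⊕ (x ⊕ y) ≡ y
⊕-cancelˡ x y = begin
  x ⊕ (x ⊕ y) ≡⟨ ⊕-assoc x x y ⟨
  (x ⊕ x) ⊕ y ≡⟨ cong (_⊕ y) (⊕-self x) ⟩
  𝟘 ⊕ y       ≡⟨ ⊕-identityˡ y ⟩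
  y           ∎
  where open ≡-Reasoning

⊕-cancelʳ : ∀ (x y : G r) → (x ⊕ y) ⊕ y ≡ x
⊕-cancelʳ x y = trans (⊕-comm (x ⊕ y) y) (trans (cong (y ⊕_) (⊕-comm x y)) (⊕-cancelˡ y x))

⊕-injectiveʳ : ∀ (s : G r) {x y} → s ⊕ x ≡ s ⊕ y → x ≡ y
⊕-injectiveʳ s {x} {y} eq =
  trans (sym (⊕-cancelˡ s x)) (trans (cong (s ⊕_) eq) (⊕-cancelˡ s y))

⊕≡𝟘⇒≡ : ∀ {x y : G r} → x ⊕ y ≡ 𝟘 → x ≡ y
⊕≡𝟘⇒≡ {x = x} {y} eq = trans (sym (⊕-identityʳ x)) (trans (cong (x ⊕_) (sym eq)) (⊕-cancelˡ x y))

⊕-exchange : ∀ {s t x y : G r} → s ⊕ x ≡ t ⊕ y → x ⊕ y ≡ s ⊕ t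
⊕-exchange {s = s} {t} {x} {y} eq = begin
  x ⊕ y             ≡⟨ ⊕-cancelˡ s (x ⊕ y) ⟨
  s ⊕ (s ⊕ (x ⊕ y)) ≡⟨ cong (s ⊕_) (⊕-assoc s x y) ⟨
  s ⊕ ((s ⊕ x) ⊕ y) ≡⟨ cong (λ w → s ⊕ (w ⊕ y)) eq ⟩
  s ⊕ ((t ⊕ y) ⊕ y) ≡⟨ cong (s ⊕_) (⊕-cancelʳ t y) ⟩
  s ⊕ t             ∎
  where open ≡-Reasoning

sumG-pairs : ∀ {u v x y : G r} → x ⊕ y ≡ u ⊕ v → sumG (u ∷ v ∷ x ∷ y ∷ []) ≡ 𝟘
sumG-pairs {u = u} {v} {x} {y} eq = begin
  u ⊕ (v ⊕ (x ⊕ (y ⊕ 𝟘))) ≡⟨ cong (λ w → u ⊕ (v ⊕ (x ⊕ w))) (⊕-identityʳ y) ⟩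
  u ⊕ (v ⊕ (x ⊕ y))       ≡⟨ ⊕-assoc u v (x ⊕ y) ⟨
  (u ⊕ v) ⊕ (x ⊕ y)       ≡⟨ cong ((u ⊕ v) ⊕_) eq ⟩
  (u ⊕ v) ⊕ (u ⊕ v)       ≡⟨ ⊕-self (u ⊕ v) ⟩
  𝟘                       ∎
  where open ≡-Reasoning

∈-─⁺ : ∀ {A : Set} {x y : A} {ys : List A} (x∈ys : x ∈ ys) → y ∈ ys → y ≢ x → y ∈ ys ─ x∈ys
∈-─⁺ (here refl)  (here refl)  y≢x = ⊥-elim (y≢x refl)
∈-─⁺ (here refl)  (there y∈ys) _   = y∈ys
∈-─⁺ (there x∈ys) (here refl)  _   = here refl
∈-─⁺ (there x∈ys) (there y∈ys) y≢x = there (∈-─⁺ x∈ys y∈ys y≢x)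

Unique-length-≤ : ∀ {A : Set} {xs ys : List A} →
                  Unique xs → (∀ {x} → x ∈ xs → x ∈ ys) → length xs ≤ length ys
Unique-length-≤ {xs = []}     _             _     = z≤n
Unique-length-≤ {xs = x ∷ xs} {ys} (x∉xs ∷ xs!) xs⊆ys = begin
  suc (length xs)           ≤⟨ s≤s (Unique-length-≤ xs! xs⊆ys─x) ⟩
  suc (length (ys ─ x∈ys)) ≡⟨ length-removeAt′ ys (index x∈ys) ⟨
  length ys                 ∎
  where
  open ≤-Reasoning
  x∈ys = xs⊆ys (here refl)
  xs⊆ys─x : ∀ {y} → y ∈ xs → y ∈ ys ─ x∈ys
  xs⊆ys─x y∈xs = ∈-─⁺ x∈ys (xs⊆ys (there y∈xs)) (≢-sym (All.lookup x∉xs y∈xs))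

∈-pair⇒⊆ : ∀ {A : Set} {x y : A} {ys : List A} → x ∈ ys → y ∈ ys → x ≢ y →
           (x ∷ y ∷ []) ⊆ ys ⊎ (y ∷ x ∷ []) ⊆ ys
∈-pair⇒⊆ (here refl)  (here refl)  x≢y = ⊥-elim (x≢y refl)
∈-pair⇒⊆ (here refl)  (there y∈ys) _   = inj₁ (refl ∷ from∈ y∈ys)
∈-pair⇒⊆ (there x∈ys) (here refl)  _   = inj₂ (refl ∷ from∈ x∈ys)
∈-pair⇒⊆ {ys = z ∷ _} (there x∈ys) (there y∈ys) x≢y with ∈-pair⇒⊆ x∈ys y∈ys x≢y
... | inj₁ xy⊆ys = inj₁ (z ∷ʳ xy⊆ys)
... | inj₂ yx⊆ys = inj₂ (z ∷ʳ yx⊆ys)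

allG : ∀ r → List (G r)
allG zero    = [] ∷ []
allG (suc r) = map (false ∷_) (allG r) ++ map (true ∷_) (allG r)

∈-allG : ∀ (v : G r) → v ∈ allG r
∈-allG []          = here refl
∈-allG (false ∷ v) = ∈-++⁺ˡ (∈-map⁺ (false ∷_) (∈-allG v))
∈-allG (true ∷ v)  = ∈-++⁺ʳ _ (∈-map⁺ (true ∷_) (∈-allG v))

length-allG : ∀ r → length (allG r) ≡ 2 ^ r
length-allG zero    = refl
length-allG (suc r) = begin
  length (map (false ∷_) (allG r) ++ map (true ∷_) (allG r))
    ≡⟨ length-++ (map (false ∷_) (allG r)) ⟩
  length (map (false ∷_) (allG r)) + length (map (true ∷_) (allG r))
    ≡⟨ cong₂ _+_ (length-map _ (allG r)) (length-map _ (allG r)) ⟩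
  length (allG r) + length (allG r)
    ≡⟨ cong (λ n → n + n) (length-allG r) ⟩
  2 ^ r + 2 ^ r
    ≡⟨ cong (2 ^ r +_) (+-identityʳ (2 ^ r)) ⟨
  2 ^ suc r
    ∎
  where open ≡-Reasoning

∷-injectiveʳ : ∀ {b : Bool} {x y : G r} → (b ∷ x) ≡ (b ∷ y) → x ≡ y
∷-injectiveʳ = cong tail

allG-unique : ∀ r → Unique (allG r)
allG-unique zero    = [] ∷ []
allG-unique (suc r) = Unique.++⁺ (Unique.map⁺ ∷-injectiveʳ (allG-unique r))
                                 (Unique.map⁺ ∷-injectiveʳ (allG-unique r))
                                 first-bits-differ
  where
  first-bits-differ : Disjoint (map (false ∷_) (allG r)) (map (true ∷_) (allG r))
  first-bits-differ (v∈false , v∈true) with ∈-map⁻ (false ∷_) v∈false | ∈-map⁻ (true ∷_) v∈true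
  ... | _ , _ , refl | _ , _ , ()

Unique-length≤2^r : ∀ {xs : List (G r)} → Unique xs → length xs ≤ 2 ^ r
Unique-length≤2^r {r} {xs} xs! =
  subst (length xs ≤_) (length-allG r) (Unique-length-≤ xs! (λ {x} _ → ∈-allG x))

AvoidsPairSums : List (G r) → G r → Set
AvoidsPairSums L w = ∀ {x y} → x ∈ L → y ∈ L → x ⊕ y ≢ w

zeroFree⇒avoidsPairSums : ∀ {B L : List (G r)} {u v} →
  ZeroFree 4 B → (u ∷ v ∷ L) ⊆ B → u ≢ v → AvoidsPairSums L (u ⊕ v)
zeroFree⇒avoidsPairSums zf uvL⊆B u≢v {x} {y} x∈L y∈L x⊕y≡u⊕v with ≡-dec Bool._≟_ x y
... | yes refl = u≢v (⊕≡𝟘⇒≡ (trans (sym x⊕y≡u⊕v) (⊕-self x)))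
... | no x≢y with ∈-pair⇒⊆ x∈L y∈L x≢y
...   | inj₁ xy⊆L = zf (_ , ⊆-trans (refl ∷ refl ∷ xy⊆L) uvL⊆B , refl , sumG-pairs x⊕y≡u⊕v)
...   | inj₂ yx⊆L =
  zf (_ , ⊆-trans (refl ∷ refl ∷ yx⊆L) uvL⊆B , refl , sumG-pairs (trans (⊕-comm y x) x⊕y≡u⊕v))

translate : G r → List (G r) → List (G r)
translate s = map (s ⊕_)

translates-disjoint : ∀ {L : List (G r)} {s t} →
  AvoidsPairSums L (s ⊕ t) → Disjoint (translate s L) (translate t L)
translates-disjoint {s = s} {t} avoids (z∈s+L , z∈t+L)
  with ∈-map⁻ (s ⊕_) z∈s+L | ∈-map⁻ (t ⊕_) z∈t+L
... | x , x∈L , refl | y , y∈L , s⊕x≡t⊕y = avoids x∈L y∈L (⊕-exchange s⊕x≡t⊕y)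

length-translates : ∀ (S L : List (G r)) →
  length (concatMap (λ s → translate s L) S) ≡ length S * length L
length-translates []      L = refl
length-translates (s ∷ S) L = begin
  length (translate s L ++ concatMap (λ s → translate s L) S)
    ≡⟨ length-++ (translate s L) ⟩
  length (translate s L) + length (concatMap (λ s → translate s L) S)
    ≡⟨ cong₂ _+_ (length-map (s ⊕_) L) (length-translates S L) ⟩
  length L + length S * length L
    ∎
  where open ≡-Reasoning

translates-bound : ∀ {S L : List (G r)} → Unique L →
  AllPairs (λ s t → AvoidsPairSums L (s ⊕ t)) S → length S * length L ≤ 2 ^ r
translates-bound {S = S} {L} L! avoids =
  subst (_≤ _) (length-translates S L) (Unique-length≤2^r translates!)
  where
  translates! : Unique (concatMap (λ s → translate s L) S)
  translates! = Unique.concat⁺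
    (All.map⁺ (All.universal (λ s → Unique.map⁺ (⊕-injectiveʳ s) L!) S))
    (AllPairs.map⁺ (AllPairs.map translates-disjoint avoids))

zeroFree-length-bound : ∀ {B : List (G r)} → Unique B → ZeroFree 4 B → 3 * length B ≤ 9 + 2 ^ r
zeroFree-length-bound {B = []}            _ _ = z≤n
zeroFree-length-bound {B = _ ∷ []}        _ _ = s≤s (s≤s (s≤s z≤n))
zeroFree-length-bound {B = _ ∷ _ ∷ []}    _ _ = s≤s (s≤s (s≤s (s≤s (s≤s (s≤s z≤n)))))
zeroFree-length-bound {r} {B = a ∷ b ∷ c ∷ L} ((a≢b ∷ a≢c ∷ _) ∷ (b≢c ∷ _) ∷ _ ∷ L!) zf =
  subst (_≤ 9 + 2 ^ r) (sym (*-distribˡ-+ 3 3 (length L))) (+-monoʳ-≤ 9 (translates-bound L! avoids))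
  where
  avoids : AllPairs (λ s t → AvoidsPairSums L (s ⊕ t)) (a ∷ b ∷ c ∷ [])
  avoids = (zeroFree⇒avoidsPairSums zf (refl ∷ refl ∷ c ∷ʳ ⊆-refl) a≢b
         ∷ zeroFree⇒avoidsPairSums zf (refl ∷ b ∷ʳ refl ∷ ⊆-refl) a≢c ∷ [])
         ∷ (zeroFree⇒avoidsPairSums zf (a ∷ʳ refl ∷ refl ∷ ⊆-refl) b≢c ∷ [])
         ∷ [] ∷ []

hyperplane : ∀ r → List (G (suc r))
hyperplane r = map (false ∷_) (allG r)

head-⊕ : ∀ (x y : G (suc r)) → head (x ⊕ y) ≡ head x xor head y
head-⊕ (_ ∷ _) (_ ∷ _) = refl

head-sumG : ∀ {S : List (G (suc r))} → All ((_≡ false) ∘ head) S → head (sumG S) ≡ false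
head-sumG []                   = refl
head-sumG {S = x ∷ S} (x₀ ∷ S₀) = trans (head-⊕ x (sumG S)) (cong₂ _xor_ x₀ (head-sumG S₀))

sumsetNotAll-hyperplane : ∀ h → SumsetNotAll h (hyperplane r)
sumsetNotAll-hyperplane {r} h = true ∷ 𝟘 , λ (S , S⊆H , _ , ΣS≡true∷𝟘) →
  true≢false (trans (sym (cong head ΣS≡true∷𝟘)) (head-sumG (All-resp-⊆ S⊆H hyperplane₀)))
  where
  true≢false : true ≢ false
  true≢false ()
  hyperplane₀ : All ((_≡ false) ∘ head) (hyperplane r)
  hyperplane₀ = All.map⁺ (All.universal (λ _ → refl) (allG r))

C-lowerBound : ∀ {h c} → IsC h (suc r) c → 2 ^ r ≤ c
C-lowerBound {r} {h} {c} (_ , maximal) =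
  subst (_≤ c) (trans (length-map (false ∷_) (allG r)) (length-allG r))
    (maximal (hyperplane r) (Unique.map⁺ ∷-injectiveʳ (allG-unique r)) (sumsetNotAll-hyperplane h))

Z-upperBound : ∀ {z} → IsZ 4 r z → 3 * z ≤ 9 + 2 ^ r
Z-upperBound ((_ , B! , zf , refl) , _) = zeroFree-length-bound B! zf

n<2^n : ∀ n → n < 2 ^ n
n<2^n zero    = s≤s z≤n
n<2^n (suc n) = begin-strict
  suc n         <⟨ +-mono-≤ (m^n>0 2 n) (n<2^n n) ⟩
  2 ^ n + 2 ^ n ≡⟨ cong (2 ^ n +_) (+-identityʳ (2 ^ n)) ⟨
  2 ^ suc n     ∎
  where open ≤-Reasoning

gap-bound : ∀ {M z c h} → 3 * M + 9 ≤ h → 3 * z ≤ 9 + 2 * h → h ≤ c → M + z ≤ c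
gap-bound {M} {z} {c} {h} 3M+9≤h 3z≤9+2h h≤c = *-cancelˡ-≤ 3 (begin
  3 * (M + z)         ≡⟨ *-distribˡ-+ 3 M z ⟩
  3 * M + 3 * z       ≤⟨ +-monoʳ-≤ (3 * M) 3z≤9+2h ⟩
  3 * M + (9 + 2 * h) ≡⟨ +-assoc (3 * M) 9 (2 * h) ⟨
  3 * M + 9 + 2 * h   ≤⟨ +-monoˡ-≤ (2 * h) 3M+9≤h ⟩
  3 * h               ≤⟨ *-monoʳ-≤ 3 h≤c ⟩
  3 * c               ∎)
  where open ≤-Reasoning

proposition1p5 : ∀ (M : ℕ) → ∃ λ (R : ℕ) → ∀ (r : ℕ) → 1 ≤ r → R ≤ r →
    ∀ (c z : ℕ) → IsC 4 r c → IsZ 4 r z → M + z ≤ c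
proposition1p5 M = suc (3 * M + 9) , bound
  where
  bound : ∀ r → 1 ≤ r → suc (3 * M + 9) ≤ r → ∀ c z → IsC 4 r c → IsZ 4 r z → M + z ≤ c
  bound (suc r) _ (s≤s 3M+9≤r) c z isC isZ =
    gap-bound {M} {z} (≤-trans 3M+9≤r (<⇒≤ (n<2^n r))) (Z-upperBound isZ) (C-lowerBound isC)
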